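{- Fix $k\geq1$, let $\varphi_0,\ldots,\varphi_{k-1}$ be properties of finite subsets of $\omega$, and suppose $\{T_{j,0}<\cdots<T_{j,s_j}: j<k\}$ is a $\langle\varphi_0,\ldots,\varphi_{k-1}\rangle$-forest. Then for every function $l:\omega\to k$ there are $j<k$, $n\le s_j$, and a terminal node $\alpha$ of $T_{j,n}$ such that $l(x)=j$ for all $x\in\operatorname{ran}(\alpha)$.
   Context: For sets $X,Y\subseteq\omega$, $X<Y$ means $X$ is finite and $\max X<\min Y$. $Inc(\omega)$ is the set of all finite strictly increasing sequences of natural numbers. For a tree $T\subseteq\omega^{<\omega}$, $\operatorname{ran}(T)=\bigcup_{\alpha\in T}\operatorname{ran}(\alpha)$, $|T|=\sup_{\alpha\in T}|\alpha|$, and for trees $T,U$, $T<U$ means $\operatorname{ran}(T)<\operatorname{ran}(U)$. For a property $\chi$ of finite sets, a $\chi$-tree is a finite subtree $T$ of $Inc(\omega)$ of bounded width such that for every terminal node $\alpha\in T$, $\chi(F)$ holds for some finite $F\subseteq\operatorname{ran}(\alpha)$; a $\chi$-sequence is a finite or infinite sequence $T_0<T_1<\cdots$ of $\chi$-trees. For properties $\chi,\psi$, the $\psi$-generated subtree of a $\chi$-sequence $T_0<T_1<\cdots$ is the tree of all $\alpha\in\omega^{<\omega}$ such that $\alpha(n)\in\operatorname{ran}(T_n)$ for all $n<|\alpha|$ and $\neg\psi(F)$ holds for every finite $F\subseteq\operatorname{ran}(\alpha\upharpoonright(|\alpha|-1))$ (for $\alpha$ nonempty). A $\langle\varphi_0,\ldots,\varphi_{k-1}\rangle$-forest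 is a collection of finite sequences $\{T_{j,0}<\cdots<T_{j,s_j}: j<k\}$ such that for each $j<k$, $T_{j,0}<\cdots<T_{j,s_j}$ is a $\varphi_j$-sequence, and for each $j<k-1$ and each $n\le s_{j+1}$, the tree $T_{j+1,n}$ is the $\varphi_{j+1}$-generated subtree of $T_{j,s}<\cdots<T_{j,s+|T_{j+1,n}|-1}$, where $s=\sum_{m<n}|T_{j+1,m}|$. -}

module Defs where

open import Data.Nat using (ℕ; zero; suc; _+_; _≤_; _<_; _⊔_)
open import Data.List using (List; []; _∷_; _++_; length; concat; foldr)
open import Data.List.Membership.Propositional using (_∈_)
open import Data.List.Relation.Unary.All using (All)
open import Data.List.Relation.Unary.Linked using (Linked)
open import Data.Product using (Σ; _×_; ∃)
open import Data.Unit using (⊤)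
open import Relation.Nullary using (¬_)
open import Relation.Binary.PropositionalEquality using (_≡_)
open import Function.Bundles using (_⇔_)

-- A property of finite subsets of ω.  Finite sets are represented canonically
-- by strictly increasing lists; a property is only ever applied to such lists.
Property : Set₁
Property = List ℕ → Set

Inc : List ℕ → Set
Inc = Linked _<_

_⊆ran_ : List ℕ → List ℕ → Set
F ⊆ran α = Inc F × All (_∈ α) F

-- A finite tree is given by the finite list of its nodes.
Tree : Set
Tree = List (List ℕ)

ranT : Tree → List ℕ
ranT T = concat T

height : Tree → ℕ
height T = foldr (λ α m → length α ⊔ m) 0 T

-- T is a (nonempty, finite) subtree of Inc(ω).  Bounded width is automatic
-- for finite trees.
IsTree : Tree → Set
IsTree T = ([] ∈ T) × All Inc T × (∀ α β → (α ++ β) ∈ T → α ∈ T)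

Terminal : Tree → List ℕ → Set
Terminal T α = (α ∈ T) × (∀ β → (α ++ β) ∈ T → β ≡ [])

IsPropTree : Property → Tree → Set
IsPropTree χ T = IsTree T × (∀ α → Terminal T α → ∃ λ F → F ⊆ran α × χ F)

_<T_ : Tree → Tree → Set
T <T U = ∀ x y → x ∈ ranT T → y ∈ ranT U → x < y

-- A χ-sequence T 0 < T 1 < ... < T s (values of T beyond s are irrelevant).
IsPropSeq : Property → ℕ → (ℕ → Tree) → Set
IsPropSeq χ s T = (∀ n → n ≤ s → IsPropTree χ (T n))
                × (∀ m n → m < n → n ≤ s → T m <T T n)

Along : (ℕ → Tree) → ℕ → List ℕ → Set
Along Ts i [] = ⊤
Along Ts i (x ∷ α) = (x ∈ ranT (Ts i)) × Along Ts (suc i) α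

dropLast : List ℕ → List ℕ
dropLast [] = []
dropLast (x ∷ []) = []
dropLast (x ∷ y ∷ xs) = x ∷ dropLast (y ∷ xs)

GenCond : Property → List ℕ → Set
GenCond ψ [] = ⊤
GenCond ψ (x ∷ α) = ∀ F → F ⊆ran dropLast (x ∷ α) → ¬ ψ F

Generated : Property → (ℕ → Tree) → ℕ → List ℕ → Set
Generated ψ Ts d α = (length α ≤ d) × Along Ts 0 α × GenCond ψ α

offset : (ℕ → Tree) → ℕ → ℕ
offset T zero = zero
offset T (suc n) = offset T n + height (T n)

IsForest : (k : ℕ) → (ℕ → Property) → (ℕ → ℕ) → (ℕ → ℕ → Tree) → Set
IsForest k φ s T =
  (∀ j → j < k → IsPropSeq (φ j) (s j) (T j))
  × (∀ j → suc j < k → ∀ n → n ≤ s (suc j) →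
       (offset (T (suc j)) n + height (T (suc j) n) ≤ suc (s j))
       × (∀ α → (α ∈ T (suc j) n) ⇔
                Generated (φ (suc j)) (λ i → T j (offset (T (suc j)) n + i))
                          (height (T (suc j) n)) α))

module Submission where

-- Call tree T(j,n) "j-bounded" if every label
-- l(x), x ∈ ran(T(j,n)), is at most j.  We show by induction on j that every
-- j-bounded tree of level j yields the required terminal node; the theorem is
-- the case j = k-1, n = 0, where boundedness is just l : ω → k.
--
-- Inside a j-bounded tree T(j,n) we follow a branch whose labels all equal j.
-- At a node α with some child:
--   * j = 0: every child has label 0, so we continue;
--   * j > 0: since T(j,n) is generated by the level-(j-1) trees, the children
--     of α are exactly α⌢x for x ∈ ran(T(j-1,m)), m = offset + |α|.  Either
--     some such x has label j and we continue, or T(j-1,m) is (j-1)-bounded and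
--     the induction hypothesis finishes.
-- A branch that cannot be continued ends in a terminal node, labelled j.

open import Defs
open import Data.Nat using (ℕ; _≤_; _<_)
open import Data.List.Relation.Unary.All using (All)
open import Data.Product using (Σ; _×_; ∃)
open import Relation.Binary.PropositionalEquality using (_≡_)

open import Data.Nat using (zero; suc; _+_; _≟_; z≤n)
open import Data.Nat.Properties
  using (m≤m⊔n; m≤n⊔m; ≤-trans; ≤-refl; ≤-pred; +-suc; +-identityʳ; +-monoʳ-≤;
         n≤0⇒n≡0; ≤∧≢⇒<; n<1+n; <-trans; <-irrefl; module ≤-Reasoning)
open import Data.List using (List; []; _∷_; _++_; length; [_])
open import Data.List.Properties using (++-assoc; ≡-dec)
open import Data.List.Relation.Unary.Any using (Any; here; there; any?)
open import Data.List.Relation.Unary.All using ([]; _∷_)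
open import Data.List.Relation.Unary.All.Properties using (++⁺)
open import Data.List.Membership.Propositional using (_∈_; find; lose)
open import Data.List.Membership.Propositional.Properties using (∈-++⁺ʳ; ∈-concat⁺′)
import Data.List.Membership.DecPropositional as DecMembership
open import Data.Product using (_,_; proj₁; proj₂)
open import Data.Sum using (_⊎_; inj₁; inj₂)
open import Data.Empty using (⊥-elim)
open import Data.Unit using (tt)
open import Relation.Nullary using (¬_; Dec; yes; no)
open import Relation.Binary.PropositionalEquality using (refl; sym; trans; cong; subst)
open import Function using (id)
open import Function.Bundles using (Equivalence; _⇔_)

PrefixClosed : Tree → Set
PrefixClosed T = ∀ α β → (α ++ β) ∈ T → α ∈ T

_∈Tree?_ : (α : List ℕ) (T : Tree) → Dec (α ∈ T)
_∈Tree?_ = DecMembership._∈?_ (≡-dec _≟_)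

length-snoc : ∀ (α : List ℕ) x → length (α ++ [ x ]) ≡ suc (length α)
length-snoc [] x = refl
length-snoc (a ∷ α) x = cong suc (length-snoc α x)

length≤height : ∀ {α} (T : Tree) → α ∈ T → length α ≤ height T
length≤height (β ∷ T) (here refl) = m≤m⊔n (length β) (height T)
length≤height (β ∷ T) (there p) = ≤-trans (length≤height T p) (m≤n⊔m (length β) (height T))

last∈ranT : ∀ {α x} (T : Tree) → (α ++ [ x ]) ∈ T → x ∈ ranT T
last∈ranT {α} T p = ∈-concat⁺′ (∈-++⁺ʳ α (here refl)) p

childless⇒terminal : ∀ (T : Tree) → PrefixClosed T → ∀ {α} → α ∈ T →
  ¬ Any (λ x → (α ++ [ x ]) ∈ T) (ranT T) → Terminal T α
childless⇒terminal T closed {α} α∈T noChild = α∈T , onlyEmpty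
  where
  onlyEmpty : ∀ β → (α ++ β) ∈ T → β ≡ []
  onlyEmpty [] _ = refl
  onlyEmpty (b ∷ β) p = ⊥-elim (noChild (lose (last∈ranT T child) child))
    where
    child : (α ++ [ b ]) ∈ T
    child = closed (α ++ [ b ]) β (subst (_∈ T) (sym (++-assoc α [ b ] β)) p)

followBranch : (T : Tree) → PrefixClosed T → [] ∈ T → (P : ℕ → Set) (Q : Set) →
  (∀ α b → (α ++ [ b ]) ∈ T → All P α → Q ⊎ ∃ λ x → (α ++ [ x ]) ∈ T × P x) →
  Q ⊎ ∃ λ α → Terminal T α × All P α
followBranch T closed root P Q extend = from (height T) [] root [] ≤-refl
  where
  -- from fuel α: continue the branch at α; the invariant says the branch can
  -- still grow by at most `fuel` nodes.
  from : ∀ fuel α → α ∈ T → All P α → height T ≤ length α + fuel →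
         Q ⊎ ∃ λ β → Terminal T β × All P β
  from fuel α α∈T Pα bound with any? (λ x → (α ++ [ x ]) ∈Tree? T) (ranT T)
  ... | no noChild = inj₂ (α , childless⇒terminal T closed α∈T noChild , Pα)
  ... | yes someChild with find someChild
  ...   | b , _ , child with extend α b child Pα
  ...     | inj₁ q = inj₁ q
  ...     | inj₂ (x , child′ , Px) = continue fuel bound
    where
    grown : length (α ++ [ x ]) ≤ height T
    grown = length≤height T child′

    -- Case on the fuel: none left contradicts the existence of the child α⌢x.
    continue : ∀ remaining → height T ≤ length α + remaining → Q ⊎ ∃ λ β → Terminal T β × All P β
    continue zero bound′ = ⊥-elim (<-irrefl refl (≤-trans
      (subst (_≤ height T) (length-snoc α x) grown)
      (subst (height T ≤_) (+-identityʳ (length α)) bound′)))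
    continue (suc remaining) bound′ = from remaining (α ++ [ x ]) child′ (++⁺ Pα (Px ∷ []))
      (subst (height T ≤_) (trans (+-suc (length α) remaining) (cong (_+ remaining) (sym (length-snoc α x)))) bound′)

GenCond-snoc : ∀ ψ (α : List ℕ) x → GenCond ψ (α ++ [ x ]) ≡ (∀ F → F ⊆ran α → ¬ ψ F)
GenCond-snoc ψ [] x = refl
GenCond-snoc ψ (a ∷ α) x = cong (λ β → ∀ F → F ⊆ran β → ¬ ψ F) (dropLast-snoc (a ∷ α))
  where
  dropLast-snoc : ∀ (β : List ℕ) → dropLast (β ++ [ x ]) ≡ β
  dropLast-snoc [] = refl
  dropLast-snoc (b ∷ []) = refl
  dropLast-snoc (b ∷ c ∷ β) = cong (b ∷_) (dropLast-snoc (c ∷ β))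

Along-init : ∀ Ts i (α : List ℕ) x → Along Ts i (α ++ [ x ]) → Along Ts i α
Along-init Ts i [] x _ = tt
Along-init Ts i (a ∷ α) x (a∈ , rest) = a∈ , Along-init Ts (suc i) α x rest

Along-snoc : ∀ Ts i (α : List ℕ) x → Along Ts i α → x ∈ ranT (Ts (i + length α)) →
  Along Ts i (α ++ [ x ])
Along-snoc Ts i [] x _ x∈ = subst (λ m → x ∈ ranT (Ts m)) (+-identityʳ i) x∈ , tt
Along-snoc Ts i (a ∷ α) x (a∈ , rest) x∈ =
  a∈ , Along-snoc Ts (suc i) α x rest (subst (λ m → x ∈ ranT (Ts m)) (+-suc i (length α)) x∈)

generated-sibling : ∀ ψ Ts d (α : List ℕ) b x → Generated ψ Ts d (α ++ [ b ]) →
  x ∈ ranT (Ts (length α)) → Generated ψ Ts d (α ++ [ x ])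
generated-sibling ψ Ts d α b x (short , along , gen) x∈ =
    subst (_≤ d) (trans (length-snoc α b) (sym (length-snoc α x))) short
  , Along-snoc Ts 0 α x (Along-init Ts 0 α b along) x∈
  , subst id (sym (GenCond-snoc ψ α x)) (subst id (GenCond-snoc ψ α b) gen)

module Forest (k : ℕ) (φ : ℕ → Property) (s : ℕ → ℕ) (T : ℕ → ℕ → Tree)
              (forest : IsForest k φ s T) (l : ℕ → ℕ) where

  Conclusion : Set
  Conclusion = ∃ λ j → j < k × ∃ λ n → n ≤ s j × ∃ λ α → Terminal (T j n) α × All (λ x → l x ≡ j) α

  Bounded : ℕ → ℕ → Set
  Bounded j n = ∀ x → x ∈ ranT (T j n) → l x ≤ j

  tree : ∀ {j n} → j < k → n ≤ s j → IsTree (T j n)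
  tree {j} {n} j<k n≤s = proj₁ (proj₁ (proj₁ forest j j<k) n n≤s)

  -- The children of a node α of T(j+1,n) are read off the level-j tree with
  -- this index.
  sourceIndex : ℕ → ℕ → List ℕ → ℕ
  sourceIndex j n α = offset (T (suc j)) n + length α

  sourceIndex≤ : ∀ {j n} → suc j < k → n ≤ s (suc j) → ∀ α b →
    (α ++ [ b ]) ∈ T (suc j) n → sourceIndex j n α ≤ s j
  sourceIndex≤ {j} {n} j+1<k n≤s α b child = ≤-pred (begin
    suc (sourceIndex j n α)                            ≡⟨ sym (+-suc o (length α)) ⟩
    o + suc (length α)                                 ≡⟨ cong (o +_) (sym (length-snoc α b)) ⟩
    o + length (α ++ [ b ])                            ≤⟨ +-monoʳ-≤ o (length≤height (T (suc j) n) child) ⟩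
    o + height (T (suc j) n)                           ≤⟨ proj₁ (proj₂ forest j j+1<k n n≤s) ⟩
    suc (s j)                                          ∎)
    where
    open ≤-Reasoning
    o = offset (T (suc j)) n

  siblings : ∀ {j n} → suc j < k → n ≤ s (suc j) → ∀ α b →
    (α ++ [ b ]) ∈ T (suc j) n →
    ∀ x → x ∈ ranT (T j (sourceIndex j n α)) → (α ++ [ x ]) ∈ T (suc j) n
  siblings {j} {n} j+1<k n≤s α b child x x∈ =
    Equivalence.from (generates (α ++ [ x ]))
      (generated-sibling (φ (suc j)) _ _ α b x (Equivalence.to (generates (α ++ [ b ])) child) x∈)
    where
    generates : ∀ β → (β ∈ T (suc j) n) ⇔
      Generated (φ (suc j)) (λ i → T j (offset (T (suc j)) n + i)) (height (T (suc j) n)) β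
    generates = proj₂ (proj₂ forest j j+1<k n n≤s)

  mutual
    fromBounded : ∀ j → j < k → ∀ n → n ≤ s j → Bounded j n → Conclusion
    fromBounded j j<k n n≤s bounded
      with followBranch (T j n) (proj₂ (proj₂ (tree j<k n≤s))) (proj₁ (tree j<k n≤s))
                        (λ x → l x ≡ j) Conclusion (extend j j<k n n≤s bounded)
    ... | inj₁ done = done
    ... | inj₂ (α , terminal , labelled) = j , j<k , n , n≤s , α , terminal , labelled

    extend : ∀ j → j < k → ∀ n → n ≤ s j → Bounded j n →
      ∀ α b → (α ++ [ b ]) ∈ T j n → All (λ x → l x ≡ j) α →
      Conclusion ⊎ ∃ λ x → (α ++ [ x ]) ∈ T j n × l x ≡ j
    -- Level 0: every label is 0, so any child continues the branch.
    extend zero _ n _ bounded α b child _ =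
      inj₂ (b , child , n≤0⇒n≡0 (bounded b (last∈ranT (T zero n) child)))
    -- Level j+1: continue with a sibling labelled j+1 if there is one;
    -- otherwise the source tree is j-bounded and the induction hypothesis applies.
    extend (suc j) j+1<k n n≤s bounded α b child _
      with any? (λ x → l x ≟ suc j) (ranT (T j (sourceIndex j n α)))
    ... | yes labelled = let (x , x∈ , lx) = find labelled in
      inj₂ (x , siblings j+1<k n≤s α b child x x∈ , lx)
    ... | no unlabelled = inj₁ (fromBounded j (<-trans (n<1+n j) j+1<k) (sourceIndex j n α)
          (sourceIndex≤ j+1<k n≤s α b child) belowJ)
      where
      belowJ : Bounded j (sourceIndex j n α)
      belowJ x x∈ = ≤-pred (≤∧≢⇒< (bounded x (last∈ranT (T (suc j) n) (siblings j+1<k n≤s α b child x x∈)))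
                                  (λ lx≡ → unlabelled (lose x∈ lx≡)))

-- Lemma 2.6: start at the top level k-1 with the tree T(k-1,0), which is
-- (k-1)-bounded because l takes values below k.
lemma2p6 : (k : ℕ) → 1 ≤ k → (φ : ℕ → Property) → (s : ℕ → ℕ) → (T : ℕ → ℕ → Tree)
    → IsForest k φ s T
    → (l : ℕ → ℕ) → (∀ x → l x < k)
    → ∃ λ j → j < k × ∃ λ n → n ≤ s j × ∃ λ α → Terminal (T j n) α × All (λ x → l x ≡ j) α
lemma2p6 (suc k) _ φ s T forest l l<k =
  Forest.fromBounded (suc k) φ s T forest l k ≤-refl 0 z≤n (λ x _ → ≤-pred (l<k x))
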